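{- Let $(C_n)_{n\ge 0}$ be defined by $C_0=0$, $C_1=1$ and $C_n=\sum_{i=1}^{n-1}C_iC_{n-i}$ for $n\ge 2$. Let $(f_n)_{n\ge 1}$ be defined by $f_1=1$ and $f_n=\sum_{i=1}^{n-1}(2^iC_i-f_i)f_{n-i}$ for $n\ge 2$, and let $t_n=2^nC_n-f_n$ for $n\ge 1$. Then for every $n\ge 1$, $t_n\equiv C_n\pmod 2$.
   Context: Combinatorially, $f_n$ (resp. $t_n$) is the number of rows with value "false" (resp. "true") in the truth tables of all bracketings of the implication $p_1\to\cdots\to p_n$ with $n$ distinct propositional variables, and $2^nC_n$ is the total number of rows in all these truth tables; the formulas given may be taken as definitions here. -}

module Defs where

open import Data.Nat using (ℕ; zero; suc; _∸_)
open import Data.Integer as ℤ using (ℤ; +_)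
open import Data.Vec using (Vec; []; _∷_; lookup; reverse; _∷ʳ_)

-- Sum_{i=1}^{n-1} g i, over ℤ
sum1to : ℕ → (ℕ → ℤ) → ℤ
sum1to zero g = + 0
sum1to (suc zero) g = + 0
sum1to (suc (suc k)) g = sum1to (suc k) g ℤ.+ g (suc k)

-- We compute the table by structural recursion, producing the new entry
-- from the previous table via a total lookup (out-of-range ↦ 0, never used).

look : ∀ {n} → Vec ℤ n → ℕ → ℤ
look [] _ = + 0
look (x ∷ v) zero = x
look (x ∷ v) (suc i) = look v i

Cnext : ∀ {n} → ℕ → Vec ℤ n → ℤ
Cnext zero _ = + 0
Cnext (suc zero) _ = + 1
Cnext n v = sum1to n (λ i → look v i ℤ.* look v (n ∸ i))

Ctable : (n : ℕ) → Vec ℤ n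
Ctable zero = []
Ctable (suc n) = Ctable n ∷ʳ Cnext n (Ctable n)

C : ℕ → ℤ
C n = Cnext n (Ctable n)

-- f_1 = 1, f_n = Σ_{i=1}^{n-1} (2^i C_i − f_i) f_{n−i}  (n ≥ 2); f_0 unused (set to 0)
fnext : ∀ {n} → ℕ → Vec ℤ n → ℤ
fnext zero _ = + 0
fnext (suc zero) _ = + 1
fnext n v = sum1to n (λ i → ((+ 2) ℤ.^ i ℤ.* C i ℤ.- look v i) ℤ.* look v (n ∸ i))

ftable : (n : ℕ) → Vec ℤ n
ftable zero = []
ftable (suc n) = ftable n ∷ʳ fnext n (ftable n)

f : ℕ → ℤ
f n = fnext n (ftable n)

t : ℕ → ℤ
t n = (+ 2) ℤ.^ n ℤ.* C n ℤ.- f n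

module Submission where

-- Parity of t_n.  Write a ≈ b mod m for m ∣ a − b over ℤ.
--
-- The whole proof is the observation  f_n ≈ C_n mod 2  for n ≥ 1:
-- the factor 2^i C_i − f_i of the f-recurrence is ≈ f_i mod 2 (since
-- 2^i C_i is even and −x ≈ x), so, by strong induction, every summand of
-- the f-recurrence is congruent to the corresponding summand C_i C_{n−i}
-- of the C-recurrence.  The theorem is then the same parity step
-- t_n = 2^n C_n − f_n ≈ f_n ≈ C_n once more.

open import Defs
open import Data.Nat using (ℕ; _≥_)
open import Data.Integer using (+_; _-_)
open import Data.Integer.Divisibility using (_∣_)

open import Data.Nat using (zero; suc; _<_; _≤_; s≤s; z≤n; _∸_)
open import Data.Nat.Properties using (m<1+n⇒m<n∨m≡n; ≤-refl; <⇒≤; ∸-monoʳ-<; m<n⇒0<n∸m)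
open import Data.Nat.Induction using (<-rec)
open import Data.Integer using (ℤ; _+_; _*_; _^_)
open import Data.Integer.Divisibility.Signed as Signed using (∣⇒∣ᵤ; ∣m∣n⇒∣m+n; ∣m⇒∣m*n; ∣n⇒∣m*n)
open import Data.Integer.Tactic.RingSolver using (solve-∀)
open import Data.Vec using (Vec; []; _∷_; _∷ʳ_)
open import Data.Sum using (inj₁; inj₂)
open import Relation.Binary.PropositionalEquality using (_≡_; refl; subst; subst₂; sym; trans; cong; cong₂)

-- Congruence modulo m over ℤ.  A record rather than a plain abbreviation
-- of  m ∣ a − b , so that a and b can be inferred from a goal.
infix 4 _≈_mod_
record _≈_mod_ (a b m : ℤ) : Set where
  constructor mod-intro
  field divides-difference : m Signed.∣ (a - b)
open _≈_mod_

divides-via : ∀ {m d e} → d ≡ e → m Signed.∣ e → m Signed.∣ d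
divides-via d≡e = subst (_ Signed.∣_) (sym d≡e)

≈-refl : ∀ {m} a → a ≈ a mod m
≈-refl {m} a = mod-intro (divides-via (difference a m) (∣n⇒∣m*n (+ 0) (Signed.∣-refl {m})))
  where
  difference : ∀ a m → a - a ≡ + 0 * m
  difference = solve-∀

≈-trans : ∀ {m a b c} → a ≈ b mod m → b ≈ c mod m → a ≈ c mod m
≈-trans {m} {a} {b} {c} (mod-intro m∣a-b) (mod-intro m∣b-c) =
  mod-intro (divides-via (difference a b c) (∣m∣n⇒∣m+n m∣a-b m∣b-c))
  where
  difference : ∀ a b c → a - c ≡ (a - b) + (b - c)
  difference = solve-∀

≈-+ : ∀ {m a b a' b'} → a ≈ a' mod m → b ≈ b' mod m → a + b ≈ a' + b' mod m
≈-+ {m} {a} {b} {a'} {b'} (mod-intro m∣a-a') (mod-intro m∣b-b') =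
  mod-intro (divides-via (difference a b a' b') (∣m∣n⇒∣m+n m∣a-a' m∣b-b'))
  where
  difference : ∀ a b a' b' → (a + b) - (a' + b') ≡ (a - a') + (b - b')
  difference = solve-∀

≈-* : ∀ {m a b a' b'} → a ≈ a' mod m → b ≈ b' mod m → a * b ≈ a' * b' mod m
≈-* {m} {a} {b} {a'} {b'} (mod-intro m∣a-a') (mod-intro m∣b-b') =
  mod-intro (divides-via (difference a b a' b') (∣m∣n⇒∣m+n (∣m⇒∣m*n b m∣a-a') (∣n⇒∣m*n a' m∣b-b')))
  where
  difference : ∀ a b a' b' → (a * b) - (a' * b') ≡ (a - a') * b + a' * (b - b')
  difference = solve-∀

even-minus : ∀ a c x → + 2 * a * c - x ≈ x mod + 2
even-minus a c x = mod-intro (divides-via (difference a c x) (∣n⇒∣m*n (a * c - x) (Signed.∣-refl {+ 2})))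
  where
  difference : ∀ a c x → + 2 * a * c - x - x ≡ (a * c - x) * + 2
  difference = solve-∀

power-minus : ∀ n c x → 1 ≤ n → (+ 2) ^ n * c - x ≈ x mod + 2
power-minus (suc j) c x _ = even-minus ((+ 2) ^ j) c x

sum1to-cong : (R : ℤ → ℤ → Set) → R (+ 0) (+ 0) → (∀ {a b a' b'} → R a a' → R b b' → R (a + b) (a' + b')) →
              ∀ n g h → (∀ i → 1 ≤ i → i < n → R (g i) (h i)) → R (sum1to n g) (sum1to n h)
sum1to-cong R R-zero R-+ zero g h _ = R-zero
sum1to-cong R R-zero R-+ (suc zero) g h _ = R-zero
sum1to-cong R R-zero R-+ (suc (suc k)) g h g~h =
  R-+ (sum1to-cong R R-zero R-+ (suc k) g h (λ i 1≤i i<1+k → g~h i 1≤i (s≤s (<⇒≤ i<1+k))))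
      (g~h (suc k) (s≤s z≤n) ≤-refl)

complement-< : ∀ {i n} → 1 ≤ i → i < n → n ∸ i < n
complement-< 1≤i i<n = ∸-monoʳ-< 1≤i (<⇒≤ i<n)

look-∷ʳ : ∀ {n} (v : Vec ℤ n) x i → i < n → look (v ∷ʳ x) i ≡ look v i
look-∷ʳ (y ∷ v) x zero _ = refl
look-∷ʳ (y ∷ v) x (suc i) (s≤s i<n) = look-∷ʳ v x i i<n

look-last : ∀ {n} (v : Vec ℤ n) x → look (v ∷ʳ x) n ≡ x
look-last [] x = refl
look-last (y ∷ v) x = look-last v x

look-table : (T : (n : ℕ) → Vec ℤ n) (x : ℕ → ℤ) → (∀ n → T (suc n) ≡ T n ∷ʳ x n) →
             ∀ n i → i < n → look (T n) i ≡ x i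
look-table T x T-suc (suc n) i i<1+n rewrite T-suc n with m<1+n⇒m<n∨m≡n i<1+n
... | inj₁ i<n = trans (look-∷ʳ (T n) (x n) i i<n) (look-table T x T-suc n i i<n)
... | inj₂ refl = look-last (T n) (x i)

C-recurrence : ∀ k → let n = suc (suc k) in C n ≡ sum1to n (λ i → C i * C (n ∸ i))
C-recurrence k = sum1to-cong _≡_ refl (cong₂ _+_) n _ _ summand
  where
  n : ℕ
  n = suc (suc k)
  lookC : ∀ i → i < n → look (Ctable n) i ≡ C i
  lookC = look-table Ctable C (λ _ → refl) n
  summand : ∀ i → 1 ≤ i → i < n → look (Ctable n) i * look (Ctable n) (n ∸ i) ≡ C i * C (n ∸ i)
  summand i 1≤i i<n = cong₂ _*_ (lookC i i<n) (lookC (n ∸ i) (complement-< 1≤i i<n))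

f-recurrence : ∀ k → let n = suc (suc k) in f n ≡ sum1to n (λ i → ((+ 2) ^ i * C i - f i) * f (n ∸ i))
f-recurrence k = sum1to-cong _≡_ refl (cong₂ _+_) n _ _ summand
  where
  n : ℕ
  n = suc (suc k)
  lookf : ∀ i → i < n → look (ftable n) i ≡ f i
  lookf = look-table ftable f (λ _ → refl) n
  summand : ∀ i → 1 ≤ i → i < n →
            ((+ 2) ^ i * C i - look (ftable n) i) * look (ftable n) (n ∸ i) ≡ ((+ 2) ^ i * C i - f i) * f (n ∸ i)
  summand i 1≤i i<n = cong₂ _*_ (cong (λ y → (+ 2) ^ i * C i - y) (lookf i i<n)) (lookf (n ∸ i) (complement-< 1≤i i<n))

f≈C : ∀ n → 1 ≤ n → f n ≈ C n mod + 2
f≈C = <-rec (λ n → 1 ≤ n → f n ≈ C n mod + 2) step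
  where
  step : ∀ n → (∀ {m} → m < n → 1 ≤ m → f m ≈ C m mod + 2) → 1 ≤ n → f n ≈ C n mod + 2
  step (suc zero) _ _ = ≈-refl (C 1)
  step (suc (suc k)) ih _ =
    subst₂ (_≈_mod + 2) (sym (f-recurrence k)) (sym (C-recurrence k))
      (sum1to-cong (_≈_mod + 2) (≈-refl (+ 0)) ≈-+ n _ _ summand)
    where
    n : ℕ
    n = suc (suc k)
    summand : ∀ i → 1 ≤ i → i < n → ((+ 2) ^ i * C i - f i) * f (n ∸ i) ≈ C i * C (n ∸ i) mod + 2
    summand i 1≤i i<n =
      ≈-* (≈-trans (power-minus i (C i) (f i) 1≤i) (ih i<n 1≤i))
          (ih (complement-< 1≤i i<n) (m<n⇒0<n∸m i<n))

proposition2p7 : ∀ (n : ℕ) → n ≥ 1 → + 2 ∣ (t n - C n)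
proposition2p7 n n≥1 = ∣⇒∣ᵤ (divides-difference t≈C)
  where
  t≈C : t n ≈ C n mod + 2
  t≈C = ≈-trans (power-minus n (C n) (f n) n≥1) (f≈C n n≥1)
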